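{- Let $\pi=\sigma_1\ominus\sigma_2\ominus\cdots\ominus\sigma_p$, where each $\sigma_i$ is minus-indecomposable, and let $r$ be the number of indices $i<p$ such that $\sigma_i$ has length one. Then $$t(\pi)=p-r-1+\sum_{i=1}^p t(\sigma_i).$$
   Context: For permutations $\sigma$ of length $a$ and $\rho$ of length $b$, $\sigma\ominus\rho$ is the permutation of length $a+b$ obtained by concatenating the sequence $\sigma$ with every entry increased by $b$, followed by $\rho$ (this operation is associative); a permutation is minus-indecomposable if it cannot be written as $\sigma\ominus\rho$ with $\sigma,\rho$ nonempty. Multi-pass stack sorting: in a pass, the entries of the current input are pushed one at a time, in order, onto a stack; whenever the top of the stack is the smallest value not yet output, it is popped to the output (repeatedly); entries are never popped otherwise. When all input entries have been pushed and no pop is possible, if the stack is nonempty the remaining entries are returned to the input in their original relative order and a new pass begins. The tier $t(\pi)$ is one less than the minimum number of passes needed to output $1,\dots,n$. -}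

module Defs where

open import Data.Nat using (ℕ; zero; suc; _+_; _∸_; _≡ᵇ_)
open import Data.Bool using (if_then_else_)
open import Data.List using (List; []; _∷_; _++_; map; length; upTo; reverse)
open import Data.List.Relation.Binary.Permutation.Propositional using (_↭_)
open import Data.Product using (_×_; _,_; Σ; ∃₂)
open import Relation.Binary.PropositionalEquality using (_≡_; _≢_)
open import Relation.Nullary using (¬_)

IsPerm : List ℕ → Set
IsPerm π = π ↭ map suc (upTo (length π))

_⊖_ : List ℕ → List ℕ → List ℕ
σ ⊖ ρ = map (_+ length ρ) σ ++ ρ

infixr 5 _⊖_

⊖-all : List (List ℕ) → List ℕ
⊖-all []       = []
⊖-all (σ ∷ []) = σ
⊖-all (σ ∷ σs@(_ ∷ _)) = σ ⊖ ⊖-all σs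

MinusIndecomposable : List ℕ → Set
MinusIndecomposable π =
  IsPerm π × π ≢ [] ×
  ¬ (∃₂ λ σ ρ → IsPerm σ × IsPerm ρ × σ ≢ [] × ρ ≢ [] × π ≡ σ ⊖ ρ)

-- Multi-pass stack sorting.
-- State: m = smallest value not yet output; stack as a list with top at head.

popAll : ℕ → List ℕ → ℕ × List ℕ
popAll m []       = m , []
popAll m (y ∷ ys) = if y ≡ᵇ m then popAll (suc m) ys else (m , y ∷ ys)

pushAll : ℕ → List ℕ → List ℕ → ℕ × List ℕ
pushAll m []       st = m , st
pushAll m (x ∷ xs) st with popAll m (x ∷ st)
... | m' , st' = pushAll m' xs st'

-- one pass: returns the new "next value" and the new input, i.e. the
-- remaining stack entries in their original (input) relative order
pass : ℕ → List ℕ → ℕ × List ℕ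
pass m xs with pushAll m xs []
... | m' , st = m' , reverse st

passesFuel : ℕ → ℕ → List ℕ → ℕ
passesFuel _        m []         = 0
passesFuel zero     m (_ ∷ _)    = 0
passesFuel (suc f)  m xs@(_ ∷ _) with pass m xs
... | m' , ys = suc (passesFuel f m' ys)

-- Every pass outputs at least the current smallest remaining entry, so
-- length π passes of fuel always suffice for a permutation π.
passes : List ℕ → ℕ
passes π = passesFuel (length π) 1 π

tier : List ℕ → ℕ
tier π = passes π ∸ 1

singletonsBeforeLast : List (List ℕ) → ℕ
singletonsBeforeLast []               = 0
singletonsBeforeLast (σ ∷ [])         = 0
singletonsBeforeLast (σ ∷ σs@(_ ∷ _)) =
  (if length σ ≡ᵇ 1 then 1 else 0) + singletonsBeforeLast σs

sumTiers : List (List ℕ) → ℕ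
sumTiers []       = 0
sumTiers (σ ∷ σs) = tier σ + sumTiers σs

module Submission where

-- Write π = σ ⊖ ρ with ρ = σ₂ ⊖ ⋯ ⊖ σₚ. In every pass the entries of σ, all larger than those
-- of ρ, are pushed first and then lie untouched at the bottom of the stack, so the passes act on
-- ρ exactly as they would on ρ alone and hand σ back unchanged. Only the pass that outputs the
-- last entry of ρ goes on popping into σ. A minus-indecomposable σ of length > 1 does not end in
-- 1 (it would split off ⊖ [1]), so nothing of σ is output and σ then takes its own tier σ + 1
-- passes; a block σ = [1] is output at once and costs nothing.

open import Defs
open import Data.Nat using (ℕ; zero; suc; pred; _+_; _∸_; _≡ᵇ_; _≤_; _<_; z≤n; s≤s)
open import Data.Nat.Properties
open import Data.Nat.Induction using (<-rec)
open import Data.Nat.Tactic.RingSolver using (solve-∀)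
open import Data.Bool using (true; false; if_then_else_; T)
open import Data.List using (List; []; _∷_; _++_; _ʳ++_; [_]; map; length; upTo; applyUpTo; reverse)
open import Data.List.Properties using (reverse-selfInverse; map-upTo; ++-identityʳ; ++-conicalʳ; reverse-++; reverse-involutive; reverse-map; unfold-reverse)
open import Data.List.Membership.Propositional using (_∈_)
open import Data.List.Membership.Propositional.Properties using (∈-++⁺ʳ)
open import Data.List.Relation.Unary.Any using (here; there)
open import Data.List.Relation.Unary.All using (All; []; _∷_; tabulate)
import Data.List.Relation.Unary.All.Properties as All
open import Data.List.Relation.Binary.Permutation.Propositional using (module PermutationReasoning; _↭_; ↭-refl; ↭-sym; ↭-trans; ↭-reflexive)
open import Data.List.Relation.Binary.Permutation.Propositional.Properties using (All-resp-↭; ↭-singleton-inv; ↭-length; shift; drop-mid; ↭-reverse; ∈-resp-↭; map⁺; ++⁺; ++-comm)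
open import Data.Product using (_×_; _,_; proj₁; proj₂; ∃-syntax)
open import Data.Empty using (⊥-elim)
open import Function using (_∘_)
open import Relation.Binary.PropositionalEquality using (_≡_; _≢_; refl; sym; trans; cong; cong₂; subst; module ≡-Reasoning)
open import Relation.Nullary using (yes; no)

range : ℕ → ℕ → List ℕ
range m zero    = []
range m (suc k) = m ∷ range (suc m) k

∈-range⁻ : ∀ {y} m k → y ∈ range m k → m ≤ y × y < m + k
∈-range⁻ m (suc k) (here refl) = ≤-refl , subst (m <_) (sym (+-suc m k)) (s≤s (m≤m+n m k))
∈-range⁻ {y} m (suc k) (there y∈) with ∈-range⁻ (suc m) k y∈
... | m<y , y<m+k = <⇒≤ m<y , subst (y <_) (sym (+-suc m k)) y<m+k

map-+-range : ∀ L m k → map (_+ L) (range m k) ≡ range (m + L) k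
map-+-range L m zero    = refl
map-+-range L m (suc k) = cong (m + L ∷_) (map-+-range L (suc m) k)

map-pred-range : ∀ m k → map pred (range (suc m) k) ≡ range m k
map-pred-range m zero    = refl
map-pred-range m (suc k) = cong (m ∷_) (map-pred-range (suc m) k)

range-+ : ∀ m k j → range m (k + j) ≡ range m k ++ range (m + k) j
range-+ m zero    j = cong (λ a → range a j) (sym (+-identityʳ m))
range-+ m (suc k) j =
  cong (m ∷_) (trans (range-+ (suc m) k j) (cong (λ a → range (suc m) k ++ range a j) (sym (+-suc m k))))

applyUpTo-range : ∀ (f : ℕ → ℕ) m k → (∀ i → f i ≡ m + i) → applyUpTo f k ≡ range m k
applyUpTo-range f m zero    f≗m+ = refl
applyUpTo-range f m (suc k) f≗m+ =
  cong₂ _∷_ (trans (f≗m+ 0) (+-identityʳ m))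
            (applyUpTo-range (f ∘ suc) (suc m) k (λ i → trans (f≗m+ (suc i)) (+-suc m i)))

map-suc-upTo : ∀ n → map suc (upTo n) ≡ range 1 n
map-suc-upTo n = trans (map-upTo suc n) (applyUpTo-range suc 1 n (λ i → refl))

Spans : ℕ → ℕ → List ℕ → Set
Spans m n xs = ∃[ k ] (m + k ≡ n × xs ↭ range m k)

Spans-resp-↭ : ∀ {m n xs ys} → xs ↭ ys → Spans m n ys → Spans m n xs
Spans-resp-↭ xs↭ys (k , eq , ys↭) = k , eq , ↭-trans xs↭ys ys↭

Spans-∈ : ∀ {m n xs y} → Spans m n xs → y ∈ xs → m ≤ y × y < n
Spans-∈ {m} (k , refl , xs↭) y∈ = ∈-range⁻ m k (∈-resp-↭ xs↭ y∈)

Spans-[] : ∀ {m n} → Spans m n [] → m ≡ n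
Spans-[] (zero , eq , _)  = trans (sym (+-identityʳ _)) eq
Spans-[] (suc k , _ , []↭) with ∈-resp-↭ (↭-sym []↭) (here refl)
... | ()

Spans-drop : ∀ {m n} pre ys → Spans m n (pre ++ m ∷ ys) → Spans (suc m) n (pre ++ ys)
Spans-drop {m} pre ys (zero , _ , xs↭) with ∈-resp-↭ xs↭ (∈-++⁺ʳ pre (here refl))
... | ()
Spans-drop {m} pre ys (suc k , eq , xs↭) = k , trans (sym (+-suc m k)) eq , drop-mid pre [] xs↭

IsPerm⇒↭range : ∀ {xs} → IsPerm xs → xs ↭ range 1 (length xs)
IsPerm⇒↭range {xs} = subst (xs ↭_) (map-suc-upTo (length xs))

IsPerm⇒Spans : ∀ {xs} → IsPerm xs → Spans 1 (suc (length xs)) xs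
IsPerm⇒Spans {xs} perm = length xs , refl , IsPerm⇒↭range perm

length-range : ∀ m k → length (range m k) ≡ k
length-range m zero    = refl
length-range m (suc k) = cong suc (length-range (suc m) k)

Spans⇒IsPerm : ∀ {n xs} → Spans 1 n xs → IsPerm xs
Spans⇒IsPerm {xs = xs} (k , _ , xs↭)
  rewrite map-suc-upTo (length xs) | trans (↭-length xs↭) (length-range 1 k) = xs↭

Spans-pred : ∀ {m n xs} → Spans (suc m) (suc n) xs → Spans m n (map pred xs)
Spans-pred {m} (k , eq , xs↭) = k , suc-injective eq , ↭-trans (map⁺ pred xs↭) (↭-reflexive (map-pred-range m k))

map-+1-pred : ∀ {xs} → All (1 ≤_) xs → map (_+ 1) (map pred xs) ≡ xs
map-+1-pred []                     = refl
map-+1-pred {suc y ∷ _} (_ ∷ 1≤xs) = cong₂ _∷_ (+-comm y 1) (map-+1-pred 1≤xs)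

IsPerm-⊖ : ∀ {σ ρ} → IsPerm σ → IsPerm ρ → IsPerm (σ ⊖ ρ)
IsPerm-⊖ {σ} {ρ} σ-perm ρ-perm = Spans⇒IsPerm (L + K , refl , skew↭)
  where
  open PermutationReasoning
  L = length ρ
  K = length σ
  skew↭ : map (_+ L) σ ++ ρ ↭ range 1 (L + K)
  skew↭ = begin
    map (_+ L) σ ++ ρ                    ↭⟨ ++⁺ (map⁺ (_+ L) (IsPerm⇒↭range σ-perm)) (IsPerm⇒↭range ρ-perm) ⟩
    map (_+ L) (range 1 K) ++ range 1 L  ≡⟨ cong (_++ range 1 L) (map-+-range L 1 K) ⟩
    range (suc L) K ++ range 1 L         ↭⟨ ++-comm (range (suc L) K) (range 1 L) ⟩
    range 1 L ++ range (suc L) K         ≡⟨ sym (range-+ 1 L K) ⟩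
    range 1 (L + K)                      ∎

IsPerm-singleton : ∀ {x} → IsPerm [ x ] → x ≡ 1
IsPerm-singleton perm with ↭-singleton-inv perm
... | refl = refl

-- Otherwise w ++ [ 1 ] = (w with every entry decremented) ⊖ [ 1 ].
MinusIndecomposable-++-[1] : ∀ w → MinusIndecomposable (w ++ [ 1 ]) → w ≡ []
MinusIndecomposable-++-[1] []        _                            = refl
MinusIndecomposable-++-[1] w@(_ ∷ _) (perm , _ , indecomposable) =
  ⊥-elim (indecomposable (map pred w , [ 1 ] , Spans⇒IsPerm (Spans-pred w-spans) , ↭-refl , (λ ()) , (λ ()) , split))
  where
  w-spans : Spans 2 (suc (length (w ++ [ 1 ]))) w
  w-spans = subst (Spans 2 _) (++-identityʳ w) (Spans-drop w [] (IsPerm⇒Spans perm))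
  split : w ++ [ 1 ] ≡ map pred w ⊖ [ 1 ]
  split = cong (_++ [ 1 ]) (sym (map-+1-pred (tabulate (λ y∈w → <⇒≤ (proj₁ (Spans-∈ w-spans y∈w))))))

MinusIndecomposable-last≢1 : ∀ {σ z zs} → MinusIndecomposable σ → length σ ≢ 1 → reverse σ ≡ z ∷ zs → z ≢ 1
MinusIndecomposable-last≢1 {σ} {z} {zs} mi len≢1 rev refl =
  len≢1 (trans (cong length σ≡) (cong (λ w → length (w ++ [ 1 ])) init≡[]))
  where
  σ≡ : σ ≡ reverse zs ++ [ 1 ]
  σ≡ = trans (sym (reverse-selfInverse rev)) (unfold-reverse 1 zs)
  init≡[] : reverse zs ≡ []
  init≡[] = MinusIndecomposable-++-[1] (reverse zs) (subst MinusIndecomposable σ≡ mi)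

≡ᵇ-refl : ∀ n → (n ≡ᵇ n) ≡ true
≡ᵇ-refl zero    = refl
≡ᵇ-refl (suc n) = ≡ᵇ-refl n

popAll-hit : ∀ m ys → popAll m (m ∷ ys) ≡ popAll (suc m) ys
popAll-hit m ys rewrite ≡ᵇ-refl m = refl

popAll-miss : ∀ {m y} ys → y ≢ m → popAll m (y ∷ ys) ≡ (m , y ∷ ys)
popAll-miss {m} {y} ys y≢m with y ≡ᵇ m in eq
... | true  = ⊥-elim (y≢m (≡ᵇ⇒≡ y m (subst T (sym eq) _)))
... | false = refl

popAll-Spans : ∀ {m n} pre ys → Spans m n (pre ++ ys) → Spans (proj₁ (popAll m ys)) n (pre ++ proj₂ (popAll m ys))
popAll-Spans         pre []       sp = sp
popAll-Spans {m} {n} pre (y ∷ ys) sp with y ≟ m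
... | yes refl = subst (λ r → Spans (proj₁ r) n (pre ++ proj₂ r)) (sym (popAll-hit m ys)) (popAll-Spans pre ys (Spans-drop pre ys sp))
... | no y≢m   = subst (λ r → Spans (proj₁ r) n (pre ++ proj₂ r)) (sym (popAll-miss ys y≢m)) sp

pushAll-Spans : ∀ {m n} xs st → Spans m n (xs ++ st) → Spans (proj₁ (pushAll m xs st)) n (proj₂ (pushAll m xs st))
pushAll-Spans      []       st sp = sp
pushAll-Spans {m} (x ∷ xs) st sp =
  pushAll-Spans xs (proj₂ (popAll m (x ∷ st))) (popAll-Spans xs (x ∷ st) (Spans-resp-↭ (shift x xs st) sp))

pass-Spans : ∀ {m n} xs → Spans m n xs → Spans (proj₁ (pass m xs)) n (proj₂ (pass m xs))
pass-Spans {m} xs sp =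
  Spans-resp-↭ (↭-reverse (proj₂ (pushAll m xs [])))
    (pushAll-Spans xs [] (Spans-resp-↭ (↭-reflexive (++-identityʳ xs)) sp))

m≤popAll : ∀ m st → m ≤ proj₁ (popAll m st)
m≤popAll m []       = ≤-refl
m≤popAll m (y ∷ ys) with y ≡ᵇ m
... | true  = ≤-trans (n≤1+n m) (m≤popAll (suc m) ys)
... | false = ≤-refl

m≤pushAll : ∀ m xs st → m ≤ proj₁ (pushAll m xs st)
m≤pushAll m []       st = ≤-refl
m≤pushAll m (x ∷ xs) st = ≤-trans (m≤popAll m (x ∷ st)) (m≤pushAll _ xs _)

pushAll-outputs : ∀ m xs st → m ∈ xs → m < proj₁ (pushAll m xs st)
pushAll-outputs m (x ∷ xs) st m∈ with x ≟ m
... | yes refl rewrite popAll-hit m st = ≤-trans (m≤popAll (suc m) st) (m≤pushAll _ xs _)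
... | no x≢m with m∈
...   | here m≡x = ⊥-elim (x≢m (sym m≡x))
...   | there m∈xs rewrite popAll-miss st x≢m = pushAll-outputs m xs (x ∷ st) m∈xs

data Passes : ℕ → List ℕ → ℕ → Set where
  done : ∀ {m} → Passes m [] 0
  step : ∀ {m xs m′ ys c} → xs ≢ [] → pass m xs ≡ (m′ , ys) → Passes m′ ys c → Passes m xs (suc c)

Passes-unique : ∀ {m xs c c′} → Passes m xs c → Passes m xs c′ → c ≡ c′
Passes-unique done             done               = refl
Passes-unique done             (step xs≢[] _ _)   = ⊥-elim (xs≢[] refl)
Passes-unique (step xs≢[] _ _) done               = ⊥-elim (xs≢[] refl)
Passes-unique (step _ eq p)    (step _ eq′ p′) with trans (sym eq) eq′
... | refl = cong suc (Passes-unique p p′)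

Passes-nonempty : ∀ {m xs c} → Passes m xs c → xs ≢ [] → c ≡ suc (c ∸ 1)
Passes-nonempty done         xs≢[] = ⊥-elim (xs≢[] refl)
Passes-nonempty (step _ _ _) _     = refl

passesFuel-Passes : ∀ {m xs c} f → Passes m xs c → c ≤ f → passesFuel f m xs ≡ c
passesFuel-Passes f       done _ = refl
passesFuel-Passes {xs = []}    (suc f) (step xs≢[] _ _) _ = ⊥-elim (xs≢[] refl)
passesFuel-Passes {xs = _ ∷ _} (suc f) (step _ eq p) (s≤s c≤f) =
  cong suc (trans (cong (λ r → passesFuel f (proj₁ r) (proj₂ r)) eq) (passesFuel-Passes f p c≤f))

<-trade : ∀ {m k m′ k′} → m′ + k′ ≡ m + k → m < m′ → k′ < k
<-trade {m} {k} {m′} {k′} eq m<m′ = +-cancelˡ-< m k′ k (≤-trans (+-monoˡ-< k′ m<m′) (≤-reflexive eq))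

-- Each pass outputs the smallest remaining value, so the width k of the interval strictly drops.
Passes-exists : ∀ k {m n xs} → m + k ≡ n → xs ↭ range m k → ∃[ c ] (Passes m xs c × c ≤ k)
Passes-exists = <-rec Bounded exists
  where
  Bounded : ℕ → Set
  Bounded k = ∀ {m n xs} → m + k ≡ n → xs ↭ range m k → ∃[ c ] (Passes m xs c × c ≤ k)

  exists : ∀ k → (∀ {k′} → k′ < k → Bounded k′) → Bounded k
  exists k       rec {xs = []}    _ _ = 0 , done , z≤n
  exists zero    rec {xs = x ∷ _} _ xs↭ with ∈-resp-↭ xs↭ (here refl)
  ... | ()
  exists (suc k) rec {m} {n} {x ∷ xs} eq xs↭ = continue (pass-Spans (x ∷ xs) (suc k , eq , xs↭))
    where
    m<m′ : m < proj₁ (pass m (x ∷ xs))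
    m<m′ = pushAll-outputs m (x ∷ xs) [] (∈-resp-↭ (↭-sym xs↭) (here refl))

    continue : Spans (proj₁ (pass m (x ∷ xs))) n (proj₂ (pass m (x ∷ xs))) → ∃[ c ] (Passes m (x ∷ xs) c × c ≤ suc k)
    continue (k′ , eq′ , ys↭) with <-trade (trans eq′ (sym eq)) m<m′
    ... | k′<k with rec k′<k eq′ ys↭
    ...   | c , p , c≤k′ = suc c , step (λ ()) refl p , ≤-trans (s≤s c≤k′) k′<k

passes-Passes : ∀ {xs} → IsPerm xs → Passes 1 xs (passes xs)
passes-Passes {xs} perm with IsPerm⇒Spans perm
... | _ , refl , xs↭ with Passes-exists (length xs) refl xs↭
...   | c , p , c≤ = subst (Passes 1 xs) (sym (passesFuel-Passes (length xs) p c≤)) p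

passes≡suc-tier : ∀ {xs} → IsPerm xs → xs ≢ [] → passes xs ≡ suc (tier xs)
passes≡suc-tier perm = Passes-nonempty (passes-Passes perm)

-- pass m xs is definitionally flipStack (pushAll m xs []).
flipStack : ℕ × List ℕ → ℕ × List ℕ
flipStack (m , st) = m , reverse st

shiftState : ℕ → ℕ × List ℕ → ℕ × List ℕ
shiftState L (m , xs) = m + L , map (_+ L) xs

popAll-shift : ∀ L m st → popAll (m + L) (map (_+ L) st) ≡ shiftState L (popAll m st)
popAll-shift L m []       = refl
popAll-shift L m (y ∷ ys) with y ≟ m
... | yes refl = trans (popAll-hit (m + L) (map (_+ L) ys))
                       (trans (popAll-shift L (suc m) ys) (cong (shiftState L) (sym (popAll-hit m ys))))
... | no y≢m   = trans (popAll-miss (map (_+ L) ys) (y≢m ∘ +-cancelʳ-≡ L y m))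
                       (cong (shiftState L) (sym (popAll-miss ys y≢m)))

pushAll-shift : ∀ L m xs st → pushAll (m + L) (map (_+ L) xs) (map (_+ L) st) ≡ shiftState L (pushAll m xs st)
pushAll-shift L m []       st = refl
pushAll-shift L m (x ∷ xs) st =
  trans (cong (λ r → pushAll (proj₁ r) (map (_+ L) xs) (proj₂ r)) (popAll-shift L m (x ∷ st)))
        (pushAll-shift L (proj₁ (popAll m (x ∷ st))) xs (proj₂ (popAll m (x ∷ st))))

pass-shift : ∀ L m xs → pass (m + L) (map (_+ L) xs) ≡ shiftState L (pass m xs)
pass-shift L m xs = begin
  pass (m + L) (map (_+ L) xs)                            ≡⟨ cong flipStack (pushAll-shift L m xs []) ⟩
  proj₁ r + L , reverse (map (_+ L) (proj₂ r))            ≡⟨ cong (proj₁ r + L ,_) (sym (reverse-map (_+ L) (proj₂ r))) ⟩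
  shiftState L (pass m xs)                                ∎
  where
  open ≡-Reasoning
  r = pushAll m xs []

Passes-shift : ∀ L {m xs c} → Passes m xs c → Passes (m + L) (map (_+ L) xs) c
Passes-shift L done = done
Passes-shift L {xs = []}    (step xs≢[] _ _) = ⊥-elim (xs≢[] refl)
Passes-shift L {m} {x ∷ xs} (step _ eq p)    =
  step (λ ()) (trans (pass-shift L m (x ∷ xs)) (cong (shiftState L) eq)) (Passes-shift L p)

Spans-head : ∀ {m L x xs} → Spans m (suc L) (x ∷ xs) → m ≤ L
Spans-head sp with Spans-∈ sp (here refl)
... | m≤x , x<1+L = ≤-trans m≤x (≤-pred x<1+L)

above⇒≢ : ∀ {m L b} → m ≤ L → L < b → b ≢ m
above⇒≢ m≤L L<b refl = <⇒≱ L<b m≤L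

popAll-above : ∀ {m L B} → m ≤ L → All (L <_) B → popAll m B ≡ (m , B)
popAll-above m≤L []          = refl
popAll-above m≤L (L<b ∷ L<B) = popAll-miss _ (above⇒≢ m≤L L<b)

pushAll-above : ∀ {m L} xs st → m ≤ L → All (L <_) xs → pushAll m xs st ≡ (m , xs ʳ++ st)
pushAll-above []       st m≤L []            = refl
pushAll-above (x ∷ xs) st m≤L (L<x ∷ L<xs) rewrite popAll-miss st (above⇒≢ m≤L L<x) =
  pushAll-above xs (x ∷ st) m≤L L<xs

pushAll-++ : ∀ m xs ys st → pushAll m (xs ++ ys) st ≡ pushAll (proj₁ (pushAll m xs st)) ys (proj₂ (pushAll m xs st))
pushAll-++ m []       ys st = refl
pushAll-++ m (x ∷ xs) ys st = pushAll-++ _ xs ys _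

onBottom : ℕ × List ℕ → List ℕ → ℕ × List ℕ
onBottom (m , [])     B = popAll m B
onBottom (m , y ∷ ys) B = m , y ∷ ys ++ B

popAll-++ : ∀ m ys B → popAll m (ys ++ B) ≡ onBottom (popAll m ys) B
popAll-++ m []       B = refl
popAll-++ m (y ∷ ys) B with y ≡ᵇ m
... | true  = popAll-++ (suc m) ys B
... | false = refl

onBottom-nonempty : ∀ m st B → st ≢ [] → onBottom (m , st) B ≡ (m , st ++ B)
onBottom-nonempty m []      B st≢[] = ⊥-elim (st≢[] refl)
onBottom-nonempty m (_ ∷ _) B _     = refl

onBottom-below : ∀ {m L B} st → m ≤ L → All (L <_) B → onBottom (m , st) B ≡ (m , st ++ B)
onBottom-below []      m≤L L<B = popAll-above m≤L L<B
onBottom-below (_ ∷ _) _   _   = refl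

-- While values ≤ L remain to be output, the entries of B (all > L) are never touched.
pushAll-onBottom : ∀ {L B} → All (L <_) B → ∀ xs r → Spans (proj₁ r) (suc L) (xs ++ proj₂ r) →
  pushAll (proj₁ (onBottom r B)) xs (proj₂ (onBottom r B)) ≡ onBottom (pushAll (proj₁ r) xs (proj₂ r)) B
pushAll-onBottom         L<B []       r        _  = refl
pushAll-onBottom {L} {B} L<B (x ∷ xs) (m , st) sp = begin
  pushAll (proj₁ (onBottom (m , st) B)) (x ∷ xs) (proj₂ (onBottom (m , st) B))
    ≡⟨ cong (λ r → pushAll (proj₁ r) (x ∷ xs) (proj₂ r)) (onBottom-below st (Spans-head sp) L<B) ⟩
  pushAll m (x ∷ xs) (st ++ B)
    ≡⟨ cong (λ r → pushAll (proj₁ r) xs (proj₂ r)) (popAll-++ m (x ∷ st) B) ⟩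
  pushAll (proj₁ (onBottom r′ B)) xs (proj₂ (onBottom r′ B))
    ≡⟨ pushAll-onBottom L<B xs r′ (popAll-Spans xs (x ∷ st) (Spans-resp-↭ (shift x xs st) sp)) ⟩
  onBottom (pushAll m (x ∷ xs) st) B ∎
  where
  open ≡-Reasoning
  r′ = popAll m (x ∷ st)

module _ {L : ℕ} {S : List ℕ} (L<S : All (L <_) S) where

  private
    RS = reverse S

    L<RS : All (L <_) RS
    L<RS = All-resp-↭ (↭-sym (↭-reverse S)) L<S

  pushAll-skew : ∀ {m ρ} → ρ ≢ [] → Spans m (suc L) ρ → pushAll m (S ++ ρ) [] ≡ onBottom (pushAll m ρ []) RS
  pushAll-skew {m} {[]}        ρ≢[] _  = ⊥-elim (ρ≢[] refl)
  pushAll-skew {m} {ρ@(_ ∷ _)} _    sp = begin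
    pushAll m (S ++ ρ) []
      ≡⟨ pushAll-++ m S ρ [] ⟩
    pushAll (proj₁ (pushAll m S [])) ρ (proj₂ (pushAll m S []))
      ≡⟨ cong (λ r → pushAll (proj₁ r) ρ (proj₂ r)) (pushAll-above S [] m≤L L<S) ⟩
    pushAll m ρ RS
      ≡⟨ cong (λ r → pushAll (proj₁ r) ρ (proj₂ r)) (sym (onBottom-below [] m≤L L<RS)) ⟩
    pushAll (proj₁ (onBottom (m , []) RS)) ρ (proj₂ (onBottom (m , []) RS))
      ≡⟨ pushAll-onBottom L<RS ρ (m , []) (subst (Spans m (suc L)) (sym (++-identityʳ ρ)) sp) ⟩
    onBottom (pushAll m ρ []) RS ∎
    where
    open ≡-Reasoning
    m≤L = Spans-head sp

  pass-skew-continue : ∀ {m ρ m′ ρ′} → ρ ≢ [] → Spans m (suc L) ρ → pass m ρ ≡ (m′ , ρ′) → ρ′ ≢ [] →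
    pass m (S ++ ρ) ≡ (m′ , S ++ ρ′)
  pass-skew-continue {m} {ρ} {m′} {ρ′} ρ≢[] sp eq ρ′≢[] = begin
    pass m (S ++ ρ)                            ≡⟨ cong flipStack (pushAll-skew ρ≢[] sp) ⟩
    flipStack (onBottom r RS)                  ≡⟨ cong flipStack (onBottom-nonempty (proj₁ r) (proj₂ r) RS st≢[]) ⟩
    proj₁ r , reverse (proj₂ r ++ RS)          ≡⟨ cong (proj₁ r ,_) (reverse-++ (proj₂ r) RS) ⟩
    proj₁ r , reverse RS ++ reverse (proj₂ r)  ≡⟨ cong (λ xs → proj₁ r , xs ++ reverse (proj₂ r)) (reverse-involutive S) ⟩
    proj₁ r , S ++ reverse (proj₂ r)           ≡⟨ cong (λ r → proj₁ r , S ++ proj₂ r) eq ⟩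
    m′ , S ++ ρ′                               ∎
    where
    open ≡-Reasoning
    r = pushAll m ρ []
    st≢[] : proj₂ r ≢ []
    st≢[] st≡[] = ρ′≢[] (trans (sym (cong proj₂ eq)) (cong reverse st≡[]))

  pass-skew-finish : ∀ {m ρ m′ e st} → popAll (suc L) RS ≡ (e , st) → ρ ≢ [] → Spans m (suc L) ρ →
    pass m ρ ≡ (m′ , []) → pass m (S ++ ρ) ≡ (e , reverse st)
  pass-skew-finish {m} {ρ} {e = e} {st} popS ρ≢[] sp eq = begin
    pass m (S ++ ρ)                ≡⟨ cong flipStack (pushAll-skew ρ≢[] sp) ⟩
    flipStack (onBottom r RS)      ≡⟨ cong (λ r → flipStack (onBottom r RS)) (cong₂ _,_ m≡1+L st≡[]) ⟩
    flipStack (popAll (suc L) RS)  ≡⟨ cong flipStack popS ⟩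
    e , reverse st                 ∎
    where
    open ≡-Reasoning
    r = pushAll m ρ []
    m≡1+L : proj₁ r ≡ suc L
    m≡1+L = Spans-[] (subst (Spans (proj₁ r) (suc L)) (cong proj₂ eq) (pass-Spans ρ sp))
    st≡[] : proj₂ r ≡ []
    st≡[] = sym (reverse-selfInverse (cong proj₂ eq))

  -- popS is the state once the pass that exhausts ρ has gone on popping into S.
  Passes-skew : ∀ {e st b} → popAll (suc L) RS ≡ (e , st) → Passes e (reverse st) b →
    ∀ {m ρ c} → Spans m (suc L) ρ → Passes m ρ (suc c) → Passes m (S ++ ρ) (suc c + b)
  Passes-skew popS rest sp (step ρ≢[] eq done) =
    step (ρ≢[] ∘ ++-conicalʳ S _) (pass-skew-finish popS ρ≢[] sp eq) rest
  Passes-skew popS rest sp (step ρ≢[] eq p@(step ρ′≢[] _ _)) =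
    step (ρ≢[] ∘ ++-conicalʳ S _) (pass-skew-continue ρ≢[] sp eq ρ′≢[])
         (Passes-skew popS rest (subst (λ r → Spans (proj₁ r) (suc L) (proj₂ r)) eq (pass-Spans _ sp)) p)

IsPerm⇒shift-above : ∀ {σ} L → IsPerm σ → All (L <_) (map (_+ L) σ)
IsPerm⇒shift-above L perm = All.map⁺ (tabulate (λ y∈σ → +-monoˡ-≤ L (proj₁ (Spans-∈ (IsPerm⇒Spans perm) y∈σ))))

popAll-stuck-on-indecomposable : ∀ {σ} L → MinusIndecomposable σ → length σ ≢ 1 →
  popAll (suc L) (reverse (map (_+ L) σ)) ≡ (suc L , reverse (map (_+ L) σ))
popAll-stuck-on-indecomposable {σ} L mi len≢1 rewrite sym (reverse-map (_+ L) σ) with reverse σ in rev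
... | []     = ⊥-elim (proj₁ (proj₂ mi) (sym (reverse-selfInverse rev)))
... | z ∷ zs = popAll-miss (map (_+ L) zs) (MinusIndecomposable-last≢1 mi len≢1 rev ∘ +-cancelʳ-≡ L z 1)

Passes-⊖ : ∀ {σ ρ c} → MinusIndecomposable σ → IsPerm ρ → Passes 1 ρ (suc c) →
  Passes 1 (σ ⊖ ρ) (suc c + ((if length σ ≡ᵇ 1 then 0 else 1) + tier σ))
Passes-⊖ {[]}    (_ , σ≢[] , _) _ _ = ⊥-elim (σ≢[] refl)
Passes-⊖ {x ∷ []} {ρ} (perm , _) ρ-perm p with IsPerm-singleton perm
... | refl = Passes-skew (n<1+n L ∷ []) (popAll-hit (suc L) []) done (IsPerm⇒Spans ρ-perm) p
  where L = length ρ
Passes-⊖ {σ@(_ ∷ _ ∷ _)} {ρ} {c} mi@(perm , σ≢[] , _) ρ-perm p =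
  subst (λ b → Passes 1 (σ ⊖ ρ) (suc c + b)) (passes≡suc-tier perm σ≢[])
    (Passes-skew (IsPerm⇒shift-above L perm) (popAll-stuck-on-indecomposable L mi (λ ())) σ-passes (IsPerm⇒Spans ρ-perm) p)
  where
  L = length ρ
  σ-passes : Passes (suc L) (reverse (reverse (map (_+ L) σ))) (passes σ)
  σ-passes = subst (λ xs → Passes (suc L) xs (passes σ)) (sym (reverse-involutive _)) (Passes-shift L (passes-Passes perm))

suc-∸-∸ : ∀ {r n} → r < n → suc n ∸ r ∸ 1 ≡ suc (n ∸ r ∸ 1)
suc-∸-∸ {zero}  {suc n} _         = refl
suc-∸-∸ {suc r} {suc n} (s≤s r<n) = suc-∸-∸ r<n

singletonsBeforeLast<length : ∀ σ σs → singletonsBeforeLast (σ ∷ σs) < length (σ ∷ σs)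
singletonsBeforeLast<length σ []       = s≤s z≤n
singletonsBeforeLast<length σ (τ ∷ σs) with length σ ≡ᵇ 1
... | true  = s≤s (singletonsBeforeLast<length τ σs)
... | false = m<n⇒m<1+n (singletonsBeforeLast<length τ σs)

length∸singletons-∷ : ∀ σ τ σs →
  length (σ ∷ τ ∷ σs) ∸ singletonsBeforeLast (σ ∷ τ ∷ σs) ∸ 1
    ≡ (if length σ ≡ᵇ 1 then 0 else 1) + (length (τ ∷ σs) ∸ singletonsBeforeLast (τ ∷ σs) ∸ 1)
length∸singletons-∷ σ τ σs with length σ ≡ᵇ 1
... | true  = refl
... | false = suc-∸-∸ (singletonsBeforeLast<length τ σs)

IsPerm×Passes-⊖-all : ∀ σs → σs ≢ [] → All MinusIndecomposable σs →
  IsPerm (⊖-all σs) × Passes 1 (⊖-all σs) (suc ((length σs ∸ singletonsBeforeLast σs ∸ 1) + sumTiers σs))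
IsPerm×Passes-⊖-all []       σs≢[] _ = ⊥-elim (σs≢[] refl)
IsPerm×Passes-⊖-all (σ ∷ []) _ ((perm , σ≢[] , _) ∷ []) =
  perm , subst (Passes 1 σ) (trans (passes≡suc-tier perm σ≢[]) (cong suc (sym (+-identityʳ (tier σ))))) (passes-Passes perm)
IsPerm×Passes-⊖-all (σ ∷ τ ∷ σs) _ (mi ∷ mis) with IsPerm×Passes-⊖-all (τ ∷ σs) (λ ()) mis
... | ρ-perm , ρ-passes =
  IsPerm-⊖ (proj₁ mi) ρ-perm ,
  subst (Passes 1 (σ ⊖ ⊖-all (τ ∷ σs))) count (Passes-⊖ mi ρ-perm ρ-passes)
  where
  q = length (τ ∷ σs) ∸ singletonsBeforeLast (τ ∷ σs) ∸ 1
  ts = sumTiers (τ ∷ σs)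
  d = if length σ ≡ᵇ 1 then 0 else 1
  t = tier σ

  regroup : ∀ a b c e → suc (a + b) + (c + e) ≡ suc ((c + a) + (e + b))
  regroup = solve-∀

  count : suc (q + ts) + (d + t) ≡ suc ((length (σ ∷ τ ∷ σs) ∸ singletonsBeforeLast (σ ∷ τ ∷ σs) ∸ 1) + (t + ts))
  count = trans (regroup q ts d t) (cong (λ p → suc (p + (t + ts))) (sym (length∸singletons-∷ σ τ σs)))

corollary3p23 : (π : List ℕ) (σs : List (List ℕ)) →
    σs ≢ [] → All MinusIndecomposable σs → π ≡ ⊖-all σs →
    tier π ≡ (length σs ∸ singletonsBeforeLast σs ∸ 1) + sumTiers σs
corollary3p23 π σs σs≢[] mis refl with IsPerm×Passes-⊖-all σs σs≢[] mis
... | perm , π-passes = cong (_∸ 1) (Passes-unique (passes-Passes perm) π-passes)
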